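{- Let $\mu$ be any $A_S$-list and let $\lambda$ be any elementary $A_S$-list consisting of $|\lambda|=n$ not necessarily distinct symbols. Let $x_1,\dots,x_k$, with $1\le k\le n$, be the distinct variables occurring in $\mu$, ordered by first appearance. Let $\mathrm{Inst}(\mu,\lambda)$ be the set of all maps assigning to each $x_j$ an elementary $A_S$-list $\kappa_j$ such that $\lambda=\mu\frac{\kappa_1}{x_1}\cdots\frac{\kappa_k}{x_k}$. Then $|\mathrm{Inst}(\mu,\lambda)|\le\binom{n-1}{k-1}$.
   Context: $A_S$ is a finite set of constant/operation symbols and $X$ a set of variables. $A_S$-lists: every $a\in A_S$ and $x\in X$ is a list; $f(\lambda)$ is a list for $f\in A_S$ and a list $\lambda$; the concatenation of two lists is a list. A list is elementary if it contains no variables. $\mu\frac{\kappa}{x}$ denotes the list obtained from $\mu$ by replacing every occurrence of the variable $x$ by $\kappa$. $|\lambda|$ is the number of symbol occurrences in $\lambda$. -}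

module Defs where

open import Data.Nat using (ℕ; zero; suc; _+_)
open import Data.Fin using (Fin)
open import Data.List using (List; []; _∷_; length; deduplicate) renaming (_++_ to _++ˡ_)
open import Data.Vec using (Vec; []; _∷_)
open import Data.Vec.Relation.Unary.All using (All)
open import Data.Product using (_×_)
open import Relation.Binary.PropositionalEquality using (_≡_)
open import Relation.Binary.Definitions using (DecidableEquality)
open import Relation.Nullary using (yes; no)

-- A_S = Fin m (a finite set of constant/operation symbols),
-- X a set of variables with decidable equality.
module Lists (m : ℕ) (X : Set) (_≟X_ : DecidableEquality X) where

  A : Set
  A = Fin m

  mutual
    data Item : Set where
      sym : A → Item
      var : X → Item
      app : A → AList → Item

    data AList : Set where
      [_] : Item → AList
      _∷_ : Item → AList → AList

  infixr 5 _++_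
  _++_ : AList → AList → AList
  [ i ] ++ ν = i ∷ ν
  (i ∷ μ) ++ ν = i ∷ (μ ++ ν)

  mutual
    sizeI : Item → ℕ
    sizeI (sym a) = 1
    sizeI (var x) = 1
    sizeI (app f λ') = suc (size λ')

    size : AList → ℕ
    size [ i ] = sizeI i
    size (i ∷ μ) = sizeI i + size μ

  mutual
    occI : Item → List X
    occI (sym a) = []
    occI (var x) = x ∷ []
    occI (app f λ') = occ λ'

    occ : AList → List X
    occ [ i ] = occI i
    occ (i ∷ μ) = occI i ++ˡ occ μ

  Elementary : AList → Set
  Elementary λ' = occ λ' ≡ []

  vars : AList → List X
  vars μ = deduplicate _≟X_ (occ μ)

  mutual
    substI : Item → X → AList → AList
    substI (sym a) x κ = [ sym a ]
    substI (var y) x κ with y ≟X x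
    ... | yes _ = κ
    ... | no _ = [ var y ]
    substI (app f λ') x κ = [ app f (subst λ' x κ) ]

    subst : AList → X → AList → AList
    subst [ i ] x κ = substI i x κ
    subst (i ∷ μ) x κ = substI i x κ ++ subst μ x κ

  substAll : AList → (xs : List X) → Vec AList (length xs) → AList
  substAll μ [] [] = μ
  substAll μ (x ∷ xs) (κ ∷ κs) = substAll (subst μ x κ) xs κs

  -- an element of Inst(μ,λ): an assignment κⱼ to each xⱼ (as a vector indexed
  -- by the position j of xⱼ in vars μ) of elementary lists with λ = μ κ₁/x₁ ⋯ κₖ/xₖ
  IsInst : (μ λ' : AList) → Vec AList (length (vars μ)) → Set
  IsInst μ λ' κs = All Elementary κs × substAll μ (vars μ) κs ≡ λ'

-- An instance is determined by the sizes |κⱼ|: once the lengths of the blocks substituted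
-- for the variables are known, λ can be parsed back along μ (unique readability).  If xⱼ
-- occurs cⱼ ≥ 1 times in μ, the numbers cⱼ|κⱼ| are positive, determine the |κⱼ|, and sum
-- to N = |λ| − (number of symbols of μ) ≤ n.  So instances inject into the compositions of
-- N into k positive parts, of which there are C(N−1,k−1) ≤ C(n−1,k−1).
module Submission where

open import Defs
open import Function using (_∘_)
open import Data.Nat using (ℕ; zero; suc; _+_; _*_; _≤_; _<_; _∸_; z≤n; s≤s; z<s; _≤′_; ≤′-reflexive; ≤′-step; >-nonZero)
open import Data.Nat.Properties
open import Data.Nat.Combinatorics using (_C_; nCk+nC[k+1]≡[n+1]C[k+1])
open import Data.Nat.ListAction using (sum)
open import Data.Nat.ListAction.Properties using (sum-++)
open import Algebra.Properties.CommutativeSemigroup +-commutativeSemigroup using (interchange; x∙yz≈y∙xz)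
open import Data.List using (List; []; _∷_; length; map) renaming (_++_ to _++ˡ_)
open import Data.List.Properties using (length-map; length-++; map-++; map-cong-local; length-removeAt′; ++-conicalˡ; ++-conicalʳ; ∷-injectiveˡ; ∷-injectiveʳ)
open import Data.List.Relation.Unary.All as All using (All; []; _∷_)
open import Data.List.Relation.Unary.All.Properties as All using (anti-mono)
open import Data.List.Relation.Unary.Any using (here; there; index; _─_)
open import Data.List.Membership.Propositional using (_∈_)
open import Data.List.Membership.Propositional.Properties using (∈-deduplicate⁺; ∈-deduplicate⁻; ∈-++⁺ˡ; ∈-++⁺ʳ; ∈-map⁺; ∈-map⁻)
open import Data.List.Relation.Binary.Subset.Propositional using (_⊆_)
open import Data.List.Relation.Unary.Unique.Propositional using (Unique; []; _∷_)
import Data.List.Relation.Unary.Unique.DecPropositional.Properties as UniqueDec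
open import Data.Vec using (Vec; []; _∷_)
import Data.Vec.Relation.Unary.All as Vec
open import Data.Product using (_×_; _,_; map₁)
open import Data.Empty using (⊥-elim)
open import Relation.Nullary using (yes; no; contradiction)
open import Relation.Binary.Definitions using (DecidableEquality)
open import Relation.Binary.PropositionalEquality using (_≡_; _≢_; refl; sym; trans; cong; cong₂; subst₂; ≢-sym; module ≡-Reasoning)

module _ {A : Set} where

  ∈-─⁺ : ∀ {x z : A} {ys} → z ∈ ys → z ≢ x → (x∈ys : x ∈ ys) → z ∈ (ys ─ x∈ys)
  ∈-─⁺ (here refl)  z≢x (here refl)  = ⊥-elim (z≢x refl)
  ∈-─⁺ (there z∈ys) _   (here _)     = z∈ys
  ∈-─⁺ (here refl)  _   (there _)    = here refl
  ∈-─⁺ (there z∈ys) z≢x (there x∈ys) = there (∈-─⁺ z∈ys z≢x x∈ys)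

  unique⊆⇒length≤ : ∀ {xs ys : List A} → Unique xs → xs ⊆ ys → length xs ≤ length ys
  unique⊆⇒length≤ []           _     = z≤n
  unique⊆⇒length≤ {x ∷ xs} {ys} (x∉xs ∷ xs!) xs⊆ys = begin
    suc _                     ≤⟨ s≤s (unique⊆⇒length≤ xs! xs⊆ys─x) ⟩
    suc (length (ys ─ x∈ys))  ≡⟨ length-removeAt′ ys (index x∈ys) ⟨
    length ys                 ∎
    where
    open ≤-Reasoning
    x∈ys : x ∈ ys
    x∈ys = xs⊆ys (here refl)
    xs⊆ys─x : xs ⊆ (ys ─ x∈ys)
    xs⊆ys─x z∈xs = ∈-─⁺ (xs⊆ys (there z∈xs)) (≢-sym (All.lookup x∉xs z∈xs)) x∈ys

module _ {A B : Set} {P : A → Set} (f : A → B)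
         (f-injectiveOn : ∀ {x y} → P x → P y → f x ≡ f y → x ≡ y) where

  map⁺-injectiveOn : ∀ {xs} → Unique xs → All P xs → Unique (map f xs)
  map⁺-injectiveOn []           []         = []
  map⁺-injectiveOn (x∉xs ∷ xs!) (px ∷ pxs) =
    All.map⁺ (All.zipWith (λ (x≢y , py) → x≢y ∘ f-injectiveOn px py) (x∉xs , pxs))
    ∷ map⁺-injectiveOn xs! pxs

  length≤-injectiveOn : ∀ {xs ys} → Unique xs → All P xs → (∀ {x} → P x → f x ∈ ys) →
                        length xs ≤ length ys
  length≤-injectiveOn {xs} {ys} xs! pxs f-into = begin
    length xs          ≡⟨ length-map f xs ⟨
    length (map f xs)  ≤⟨ unique⊆⇒length≤ (map⁺-injectiveOn xs! pxs) fxs⊆ys ⟩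
    _                  ∎
    where
    open ≤-Reasoning
    fxs⊆ys : map f xs ⊆ ys
    fxs⊆ys z∈fxs with _ , x∈xs , refl ← ∈-map⁻ f z∈fxs = f-into (All.lookup pxs x∈xs)

map≡map⇒pointwise : ∀ {A B : Set} {f g : A → B} xs → map f xs ≡ map g xs → All (λ x → f x ≡ g x) xs
map≡map⇒pointwise []       _ = []
map≡map⇒pointwise (x ∷ xs) e = ∷-injectiveˡ e ∷ map≡map⇒pointwise xs (∷-injectiveʳ e)

nC0≡1 : ∀ n → n C 0 ≡ 1
nC0≡1 zero    = refl
nC0≡1 (suc n) = refl

nCk≤[1+n]Ck : ∀ n k → n C k ≤ suc n C k
nCk≤[1+n]Ck n zero    = ≤-reflexive (trans (nC0≡1 n) (sym (nC0≡1 (suc n))))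
nCk≤[1+n]Ck n (suc k) = ≤-trans (m≤n+m _ _) (≤-reflexive (nCk+nC[k+1]≡[n+1]C[k+1] n k))

C-monoˡ-≤ : ∀ {m n} k → m ≤ n → m C k ≤ n C k
C-monoˡ-≤ k = go ∘ ≤⇒≤′
  where
  go : ∀ {m n} → m ≤′ n → m C k ≤ n C k
  go (≤′-reflexive refl) = ≤-refl
  go (≤′-step {n} m≤′n)  = ≤-trans (go m≤′n) (nCk≤[1+n]Ck n k)

incrementHead : List ℕ → List ℕ
incrementHead []      = []
incrementHead (a ∷ t) = suc a ∷ t

-- The k-tuples of positive integers with sum n, sorted by whether the first part is 1.
compositions : ℕ → ℕ → List (List ℕ)
compositions zero    zero    = [] ∷ []
compositions zero    (suc k) = []
compositions (suc n) zero    = []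
compositions (suc n) (suc k) =
  map (1 ∷_) (compositions n k) ++ˡ map incrementHead (compositions n (suc k))

length-compositions-pascal : ∀ n k →
  length (compositions (suc n) (suc k)) ≡ length (compositions n k) + length (compositions n (suc k))
length-compositions-pascal n k = begin
  length (map (1 ∷_) (compositions n k) ++ˡ map incrementHead (compositions n (suc k)))
    ≡⟨ length-++ (map (1 ∷_) (compositions n k)) ⟩
  length (map (1 ∷_) (compositions n k)) + length (map incrementHead (compositions n (suc k)))
    ≡⟨ cong₂ _+_ (length-map _ (compositions n k)) (length-map _ (compositions n (suc k))) ⟩
  length (compositions n k) + length (compositions n (suc k)) ∎
  where open ≡-Reasoning

length-compositions : ∀ n k → length (compositions (suc n) (suc k)) ≡ n C k
length-compositions zero    zero    = refl
length-compositions zero    (suc k) = refl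
length-compositions (suc n) zero    = begin
  length (compositions (suc (suc n)) 1)  ≡⟨ length-compositions-pascal (suc n) zero ⟩
  length (compositions (suc n) 1)        ≡⟨ length-compositions n zero ⟩
  n C 0                                  ≡⟨ trans (nC0≡1 n) (sym (nC0≡1 (suc n))) ⟩
  suc n C 0                              ∎
  where open ≡-Reasoning
length-compositions (suc n) (suc k) = begin
  length (compositions (suc (suc n)) (suc (suc k)))
    ≡⟨ length-compositions-pascal (suc n) (suc k) ⟩
  length (compositions (suc n) (suc k)) + length (compositions (suc n) (suc (suc k)))
    ≡⟨ cong₂ _+_ (length-compositions n k) (length-compositions n (suc k)) ⟩
  n C k + n C suc k
    ≡⟨ nCk+nC[k+1]≡[n+1]C[k+1] n k ⟩
  suc n C suc k ∎
  where open ≡-Reasoning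

length-compositions≤ : ∀ {N n k} → N ≤ n → 0 < k → length (compositions N k) ≤ (n ∸ 1) C (k ∸ 1)
length-compositions≤ {zero}  {_}     {suc k} _         _ = z≤n
length-compositions≤ {suc N} {suc n} {suc k} (s≤s N≤n) _ =
  ≤-trans (≤-reflexive (length-compositions N k)) (C-monoˡ-≤ k N≤n)

mutual
  ∈-compositions : ∀ t → All (0 <_) t → t ∈ compositions (sum t) (length t)
  ∈-compositions []          []       = here refl
  ∈-compositions (suc a ∷ t) (_ ∷ t⁺) = ∷-∈-compositions a t t⁺

  ∷-∈-compositions : ∀ a t → All (0 <_) t →
                     suc a ∷ t ∈ compositions (suc a + sum t) (suc (length t))
  ∷-∈-compositions zero    t t⁺ = ∈-++⁺ˡ (∈-map⁺ (1 ∷_) (∈-compositions t t⁺))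
  ∷-∈-compositions (suc a) t t⁺ = ∈-++⁺ʳ _ (∈-map⁺ incrementHead (∷-∈-compositions a t t⁺))

module Multiplicity {A : Set} (_≟_ : DecidableEquality A) where

  count : A → List A → ℕ
  count y []      = 0
  count y (a ∷ l) with a ≟ y
  ... | yes _ = suc (count y l)
  ... | no  _ = count y l

  0<count : ∀ {y l} → y ∈ l → 0 < count y l
  0<count {y} {a ∷ l} (here refl) with a ≟ a
  ... | yes _   = z<s
  ... | no  a≢a = contradiction refl a≢a
  0<count {y} {a ∷ l} (there y∈l) with a ≟ y
  ... | yes _ = z<s
  ... | no  _ = 0<count y∈l

  count-∷-≢ : ∀ {a y} l → a ≢ y → count y (a ∷ l) ≡ count y l
  count-∷-≢ {a} {y} l a≢y with a ≟ y
  ... | yes a≡y = contradiction a≡y a≢y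
  ... | no  _   = refl

  module _ (g : A → ℕ) where

    sum-count-∷ : ∀ a l {xs} → Unique xs → a ∈ xs →
      sum (map (λ y → count y (a ∷ l) * g y) xs) ≡ g a + sum (map (λ y → count y l * g y) xs)
    sum-count-∷ a l {y ∷ ys} (y∉ys ∷ ys!) a∈xs with a ≟ y
    sum-count-∷ a l {a ∷ ys} (a∉ys ∷ ys!) _ | yes refl = begin
      (g a + count a l * g a) + sum (map (λ z → count z (a ∷ l) * g z) ys)
        ≡⟨ cong (λ s → (g a + count a l * g a) + sum s)
                (map-cong-local (All.map (λ a≢z → cong (_* g _) (count-∷-≢ l a≢z)) a∉ys)) ⟩
      (g a + count a l * g a) + sum (map (λ z → count z l * g z) ys)
        ≡⟨ +-assoc (g a) _ _ ⟩
      g a + (count a l * g a + sum (map (λ z → count z l * g z) ys)) ∎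
      where open ≡-Reasoning
    ... | no a≢y with a∈xs
    ...   | here a≡y    = contradiction a≡y a≢y
    ...   | there a∈ys = trans (cong (count y l * g y +_) (sum-count-∷ a l ys! a∈ys))
                               (x∙yz≈y∙xz (count y l * g y) (g a) _)

    sum-map-count : ∀ l {xs} → Unique xs → l ⊆ xs →
                    sum (map (λ y → count y l * g y) xs) ≡ sum (map g l)
    sum-map-count []      {xs} _   _    = sum-zeros xs
      where
      sum-zeros : ∀ xs → sum (map (λ _ → 0) xs) ≡ 0
      sum-zeros []       = refl
      sum-zeros (_ ∷ xs) = sum-zeros xs
    sum-map-count (a ∷ l) xs!      l⊆xs =
      trans (sum-count-∷ a l xs! (l⊆xs (here refl)))
            (cong (g a +_) (sum-map-count l xs! (l⊆xs ∘ there)))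

module Instantiation (m : ℕ) (X : Set) (_≟X_ : DecidableEquality X) where
  open Lists m X _≟X_ renaming (sym to symbol)
  open Multiplicity _≟X_

  Env : Set
  Env = X → AList

  idEnv : Env
  idEnv y = [ var y ]

  mutual
    instItem : Item → Env → AList
    instItem (symbol a) τ = [ symbol a ]
    instItem (var x)    τ = τ x
    instItem (app f l)  τ = [ app f (inst l τ) ]

    inst : AList → Env → AList
    inst [ i ]   τ = instItem i τ
    inst (i ∷ l) τ = instItem i τ ++ inst l τ

  ++-assoc : ∀ a b c → (a ++ b) ++ c ≡ a ++ (b ++ c)
  ++-assoc [ i ]   b c = refl
  ++-assoc (i ∷ a) b c = cong (i ∷_) (++-assoc a b c)

  inst-++ : ∀ a b τ → inst (a ++ b) τ ≡ inst a τ ++ inst b τ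
  inst-++ [ i ]   b τ = refl
  inst-++ (i ∷ a) b τ =
    trans (cong (instItem i τ ++_) (inst-++ a b τ)) (sym (++-assoc (instItem i τ) _ _))

  mutual
    instItem-elementary : ∀ i τ → occI i ≡ [] → instItem i τ ≡ [ i ]
    instItem-elementary (symbol a) τ _  = refl
    instItem-elementary (var x)    τ ()
    instItem-elementary (app f l)  τ el = cong (λ l′ → [ app f l′ ]) (inst-elementary l τ el)

    inst-elementary : ∀ l τ → Elementary l → inst l τ ≡ l
    inst-elementary [ i ]   τ el = instItem-elementary i τ el
    inst-elementary (i ∷ l) τ el = cong₂ _++_ (instItem-elementary i τ (++-conicalˡ (occI i) _ el))
                                              (inst-elementary l τ (++-conicalʳ (occI i) _ el))

  mutual
    instItem-idEnv : ∀ i → instItem i idEnv ≡ [ i ]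
    instItem-idEnv (symbol a) = refl
    instItem-idEnv (var x)    = refl
    instItem-idEnv (app f l)  = cong (λ l′ → [ app f l′ ]) (inst-idEnv l)

    inst-idEnv : ∀ l → inst l idEnv ≡ l
    inst-idEnv [ i ]   = instItem-idEnv i
    inst-idEnv (i ∷ l) = cong₂ _++_ (instItem-idEnv i) (inst-idEnv l)

  update : X → AList → Env → Env
  update x κ τ y with y ≟X x
  ... | yes _ = κ
  ... | no  _ = τ y

  update-≡ : ∀ x κ τ → update x κ τ x ≡ κ
  update-≡ x κ τ with x ≟X x
  ... | yes _   = refl
  ... | no  x≢x = contradiction refl x≢x

  update-≢ : ∀ {x y} κ τ → y ≢ x → update x κ τ y ≡ τ y
  update-≢ {x} {y} κ τ y≢x with y ≟X x
  ... | yes y≡x = contradiction y≡x y≢x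
  ... | no  _   = refl

  mutual
    instItem-subst : ∀ i x κ τ → Elementary κ → inst (substI i x κ) τ ≡ instItem i (update x κ τ)
    instItem-subst (symbol a) x κ τ _    = refl
    instItem-subst (var y)    x κ τ κ-el with y ≟X x
    ... | yes _ = inst-elementary κ τ κ-el
    ... | no  _ = refl
    instItem-subst (app f l)  x κ τ κ-el = cong (λ l′ → [ app f l′ ]) (inst-subst l x κ τ κ-el)

    inst-subst : ∀ l x κ τ → Elementary κ → inst (subst l x κ) τ ≡ inst l (update x κ τ)
    inst-subst [ i ]   x κ τ κ-el = instItem-subst i x κ τ κ-el
    inst-subst (i ∷ l) x κ τ κ-el = trans (inst-++ (substI i x κ) (subst l x κ) τ)
                                          (cong₂ _++_ (instItem-subst i x κ τ κ-el) (inst-subst l x κ τ κ-el))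

  assignment : (xs : List X) → Vec AList (length xs) → Env
  assignment []       []       = idEnv
  assignment (x ∷ xs) (κ ∷ κs) = update x κ (assignment xs κs)

  substAll-inst : ∀ μ xs κs → Vec.All Elementary κs → substAll μ xs κs ≡ inst μ (assignment xs κs)
  substAll-inst μ []       []       _                 = sym (inst-idEnv μ)
  substAll-inst μ (x ∷ xs) (κ ∷ κs) (κ-el Vec.∷ κs-el) =
    trans (substAll-inst (subst μ x κ) xs κs κs-el) (inst-subst μ x κ (assignment xs κs) κ-el)

  assignment-injective : ∀ {xs} κs κs′ → Unique xs →
    All (λ y → assignment xs κs y ≡ assignment xs κs′ y) xs → κs ≡ κs′
  assignment-injective []       []         []           []         = refl
  assignment-injective {x ∷ xs} (κ ∷ κs) (κ′ ∷ κs′) (x∉xs ∷ xs!) (eq ∷ eqs) =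
    cong₂ _∷_ (trans (sym (update-≡ x κ τ)) (trans eq (update-≡ x κ′ τ′)))
              (assignment-injective κs κs′ xs! (All.zipWith elsewhere (x∉xs , eqs)))
    where
    τ = assignment xs κs
    τ′ = assignment xs κs′
    elsewhere : ∀ {y} → x ≢ y × update x κ τ y ≡ update x κ′ τ′ y → τ y ≡ τ′ y
    elsewhere (x≢y , e) = trans (sym (update-≢ κ τ (≢-sym x≢y))) (trans e (update-≢ κ′ τ′ (≢-sym x≢y)))

  mutual
    symbolsItem : Item → ℕ
    symbolsItem (symbol a) = 1
    symbolsItem (var x)    = 0
    symbolsItem (app f l)  = suc (symbols l)

    symbols : AList → ℕ
    symbols [ i ]   = symbolsItem i
    symbols (i ∷ l) = symbolsItem i + symbols l

  size-++ : ∀ a b → size (a ++ b) ≡ size a + size b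
  size-++ [ i ]   b = refl
  size-++ (i ∷ a) b = trans (cong (sizeI i +_) (size-++ a b)) (sym (+-assoc (sizeI i) _ _))

  sum-map-++ : ∀ (g : X → ℕ) xs ys → sum (map g (xs ++ˡ ys)) ≡ sum (map g xs) + sum (map g ys)
  sum-map-++ g xs ys = trans (cong sum (map-++ g xs ys)) (sum-++ (map g xs) _)

  mutual
    size-instItem : ∀ i τ → size (instItem i τ) ≡ symbolsItem i + sum (map (size ∘ τ) (occI i))
    size-instItem (symbol a) τ = refl
    size-instItem (var x)    τ = sym (+-identityʳ _)
    size-instItem (app f l)  τ = cong suc (size-inst l τ)

    size-inst : ∀ l τ → size (inst l τ) ≡ symbols l + sum (map (size ∘ τ) (occ l))
    size-inst [ i ]   τ = size-instItem i τ
    size-inst (i ∷ l) τ = begin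
      size (instItem i τ ++ inst l τ)
        ≡⟨ size-++ (instItem i τ) _ ⟩
      size (instItem i τ) + size (inst l τ)
        ≡⟨ cong₂ _+_ (size-instItem i τ) (size-inst l τ) ⟩
      (symbolsItem i + sum (map (size ∘ τ) (occI i))) + (symbols l + sum (map (size ∘ τ) (occ l)))
        ≡⟨ interchange (symbolsItem i) _ _ _ ⟩
      (symbolsItem i + symbols l) + (sum (map (size ∘ τ) (occI i)) + sum (map (size ∘ τ) (occ l)))
        ≡⟨ cong (symbolsItem i + symbols l +_) (sum-map-++ (size ∘ τ) (occI i) _) ⟨
      (symbolsItem i + symbols l) + sum (map (size ∘ τ) (occI i ++ˡ occ l)) ∎
      where open ≡-Reasoning

  0<sizeI : ∀ i → 0 < sizeI i
  0<sizeI (symbol a) = z<s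
  0<sizeI (var x)    = z<s
  0<sizeI (app f l)  = z<s

  0<size : ∀ l → 0 < size l
  0<size [ i ]   = 0<sizeI i
  0<size (i ∷ l) = ≤-trans (0<sizeI i) (m≤m+n _ _)

  ∷-injectiveᴬ : ∀ {i j a b} → _≡_ {A = AList} (i ∷ a) (j ∷ b) → i ≡ j × a ≡ b
  ∷-injectiveᴬ refl = refl , refl

  sizeI≢size-∷ : ∀ i a → sizeI i ≢ size (i ∷ a)
  sizeI≢size-∷ i a = <⇒≢ (m<m+n (sizeI i) (0<size a))

  ++-cancel-size : ∀ a a′ b b′ → a ++ b ≡ a′ ++ b′ → size a ≡ size a′ → a ≡ a′ × b ≡ b′
  ++-cancel-size [ i ]   [ _ ]      _ _  refl _ = refl , refl
  ++-cancel-size [ i ]   (_ ∷ a′)   _ _  refl s = contradiction s (sizeI≢size-∷ i a′)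
  ++-cancel-size (i ∷ a) [ _ ]      b b′ e    s with refl , _ ← ∷-injectiveᴬ e =
    contradiction (sym s) (sizeI≢size-∷ i a)
  ++-cancel-size (i ∷ a) (i′ ∷ a′)  b b′ e    s with refl , e′ ← ∷-injectiveᴬ e =
    map₁ (cong (i ∷_)) (++-cancel-size a a′ b b′ e′ (+-cancelˡ-≡ (sizeI i) _ _ s))

  SameSizes : Env → Env → List X → Set
  SameSizes τ τ′ = All (λ x → size (τ x) ≡ size (τ′ x))

  size-instItem-cong : ∀ i {τ τ′} → SameSizes τ τ′ (occI i) → size (instItem i τ) ≡ size (instItem i τ′)
  size-instItem-cong i {τ} {τ′} sizes = begin
    size (instItem i τ)                                ≡⟨ size-instItem i τ ⟩
    symbolsItem i + sum (map (size ∘ τ) (occI i))      ≡⟨ cong (λ s → symbolsItem i + sum s) (map-cong-local sizes) ⟩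
    symbolsItem i + sum (map (size ∘ τ′) (occI i))     ≡⟨ size-instItem i τ′ ⟨
    size (instItem i τ′)                               ∎
    where open ≡-Reasoning

  app-injective : ∀ {f g l l′} → [ app f l ] ≡ [ app g l′ ] → l ≡ l′
  app-injective refl = refl

  mutual
    instItem-injective : ∀ i {τ τ′} → SameSizes τ τ′ (occI i) → instItem i τ ≡ instItem i τ′ →
                         All (λ x → τ x ≡ τ′ x) (occI i)
    instItem-injective (symbol a) _     _ = []
    instItem-injective (var x)    _     e = e ∷ []
    instItem-injective (app f l)  sizes e = inst-injective l sizes (app-injective e)

    inst-injective : ∀ l {τ τ′} → SameSizes τ τ′ (occ l) → inst l τ ≡ inst l τ′ →
                     All (λ x → τ x ≡ τ′ x) (occ l)
    inst-injective [ i ]   sizes e = instItem-injective i sizes e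
    inst-injective (i ∷ l) sizes e =
      let (sizesᵢ , sizesₗ) = All.++⁻ (occI i) sizes
          (eᵢ , eₗ) = ++-cancel-size _ _ _ _ e (size-instItem-cong i sizesᵢ)
      in All.++⁺ (instItem-injective i sizesᵢ eᵢ) (inst-injective l sizesₗ eₗ)

  module _ (μ λ′ : AList) where

    vars-unique : Unique (vars μ)
    vars-unique = UniqueDec.deduplicate-! _≟X_ (occ μ)

    weightedSizes : Vec AList (length (vars μ)) → List ℕ
    weightedSizes κs = map (λ y → count y (occ μ) * size (assignment (vars μ) κs y)) (vars μ)

    inst-assignment : ∀ {κs} → IsInst μ λ′ κs → inst μ (assignment (vars μ) κs) ≡ λ′
    inst-assignment {κs} (κs-el , eq) = trans (sym (substAll-inst μ (vars μ) κs κs-el)) eq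

    sum-weightedSizes : ∀ {κs} → IsInst μ λ′ κs → sum (weightedSizes κs) ≡ size λ′ ∸ symbols μ
    sum-weightedSizes {κs} isInst = begin
      sum (weightedSizes κs)              ≡⟨ sum-map-count (size ∘ τ) (occ μ) vars-unique (∈-deduplicate⁺ _≟X_) ⟩
      sum (map (size ∘ τ) (occ μ))        ≡⟨ m+n∸m≡n (symbols μ) _ ⟨
      symbols μ + _ ∸ symbols μ           ≡⟨ cong (_∸ symbols μ) (size-inst μ τ) ⟨
      size (inst μ τ) ∸ symbols μ         ≡⟨ cong (λ l → size l ∸ symbols μ) (inst-assignment isInst) ⟩
      size λ′ ∸ symbols μ                 ∎
      where
      open ≡-Reasoning
      τ = assignment (vars μ) κs

    weightedSizes-positive : ∀ κs → All (0 <_) (weightedSizes κs)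
    weightedSizes-positive κs = All.map⁺ (All.tabulate λ y∈vars →
      *-mono-≤ (0<count (∈-deduplicate⁻ _≟X_ (occ μ) y∈vars)) (0<size (assignment (vars μ) κs _)))

    weightedSizes∈compositions : ∀ {κs} → IsInst μ λ′ κs →
      weightedSizes κs ∈ compositions (size λ′ ∸ symbols μ) (length (vars μ))
    weightedSizes∈compositions {κs} isInst =
      subst₂ (λ n k → weightedSizes κs ∈ compositions n k) (sum-weightedSizes isInst) (length-map _ (vars μ))
             (∈-compositions (weightedSizes κs) (weightedSizes-positive κs))

    weightedSizes-injectiveOn : ∀ {κs κs′} → IsInst μ λ′ κs → IsInst μ λ′ κs′ →
                                weightedSizes κs ≡ weightedSizes κs′ → κs ≡ κs′
    weightedSizes-injectiveOn {κs} {κs′} isInst isInst′ eq =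
      assignment-injective κs κs′ vars-unique (anti-mono (∈-deduplicate⁻ _≟X_ (occ μ)) agree)
      where
      τ = assignment (vars μ) κs
      τ′ = assignment (vars μ) κs′
      sizes : SameSizes τ τ′ (occ μ)
      sizes = All.tabulate λ {y} y∈occ →
        *-cancelˡ-≡ _ _ (count y (occ μ)) {{>-nonZero (0<count y∈occ)}}
          (All.lookup (map≡map⇒pointwise (vars μ) eq) (∈-deduplicate⁺ _≟X_ y∈occ))
      agree : All (λ y → τ y ≡ τ′ y) (occ μ)
      agree = inst-injective μ sizes (trans (inst-assignment isInst) (sym (inst-assignment isInst′)))

mainTheorem5 : (m : ℕ) (X : Set) (_≟X_ : DecidableEquality X) →
    let open Lists m X _≟X_ in
    (μ λ' : AList) → Elementary λ' →
    1 ≤ length (vars μ) → length (vars μ) ≤ size λ' →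
    (S : List (Vec AList (length (vars μ)))) → Unique S → All (IsInst μ λ') S →
    length S ≤ (size λ' ∸ 1) C (length (vars μ) ∸ 1)
mainTheorem5 m X _≟X_ μ λ′ _ 0<k _ S S! S-insts = begin
  length S
    ≤⟨ length≤-injectiveOn (weightedSizes μ λ′) (weightedSizes-injectiveOn μ λ′)
                           S! S-insts (weightedSizes∈compositions μ λ′) ⟩
  length (compositions (size λ′ ∸ symbols μ) (length (vars μ)))
    ≤⟨ length-compositions≤ (m∸n≤m (size λ′) (symbols μ)) 0<k ⟩
  (size λ′ ∸ 1) C (length (vars μ) ∸ 1) ∎
  where
  open Lists m X _≟X_
  open Instantiation m X _≟X_
  open ≤-Reasoning
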